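{- For integers $n\ge 0$ and $k$, let $c_{n,k}$ denote the number of tilings of the honeycomb strip $H_n$ using exactly $k$ dimers and $n-2k$ monomers (with $c_{n,k}=0$ for $k<0$). Then for every integer $n\ge 4$, $$c_{n,k}=c_{n-1,k}+c_{n-2,k-1}+c_{n-3,k-1}+c_{n-4,k-2},$$ with initial conditions $c_{0,0}=c_{1,0}=c_{2,0}=c_{3,0}=1$, $c_{2,1}=1$, $c_{3,1}=3$.
   Context: The honeycomb strip $H_n$ consists of $n$ regular hexagons arranged in two rows, numbered $1,\dots,n$ from the bottom left so that odd-numbered hexagons form the bottom row and even-numbered ones the top row; hexagon $i$ shares an edge with hexagons $i\pm1$ and $i\pm2$ (when they exist), and with no others. A monomer is a single hexagon; a dimer is a pair of edge-adjacent hexagons, i.e. either $\{i,i+1\}$ (a slanted dimer) or $\{i,i+2\}$ (a horizontal dimer). A tiling of $H_n$ is a partition of its $n$ hexagons into monomers and dimers. The empty strip $H_0$ has exactly one (empty) tiling. -}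

module Defs where

open import Data.Bool using (Bool; true; false; _∧_; if_then_else_)
open import Data.Nat using (ℕ; zero; suc; _+_; _∸_; _≡ᵇ_)
open import Data.Bool.ListAction using (and; any)
open import Data.Integer using (ℤ; +_; -[1+_])
open import Data.List using (List; []; _∷_; _++_; map; length; filterᵇ; upTo)

-- Hexagons of H_n are labelled 1,…,n.  Hexagon i is edge-adjacent exactly
-- to i±1 and i±2 (when they exist).
hexagons : ℕ → List ℕ
hexagons n = map suc (upTo n)

-- A tile is the set of hexagons it covers, written as a list of labels.
Tile : Set
Tile = List ℕ

monomers : ℕ → List Tile
monomers n = map (λ i → i ∷ []) (hexagons n)

slanted : ℕ → List Tile
slanted n = map (λ i → i ∷ suc i ∷ []) (hexagons (n ∸ 1))

horizontal : ℕ → List Tile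
horizontal n = map (λ i → i ∷ suc (suc i) ∷ []) (hexagons (n ∸ 2))

tiles : ℕ → List Tile
tiles n = monomers n ++ slanted n ++ horizontal n

-- all sub-collections (sublists) of a list: the subsets of a duplicate-free list
sublists : {A : Set} → List A → List (List A)
sublists []       = [] ∷ []
sublists (x ∷ xs) = let r = sublists xs in r ++ map (x ∷_) r

memberᵇ : ℕ → List ℕ → Bool
memberᵇ h t = any (h ≡ᵇ_) t

cover : List Tile → ℕ → ℕ
cover T h = length (filterᵇ (memberᵇ h) T)

-- T is a partition of the hexagons of H_n: every hexagon lies in exactly one tile
-- (tiles of H_n only contain hexagons of H_n by construction)
isPartitionᵇ : ℕ → List Tile → Bool
isPartitionᵇ n T = and (map (λ h → cover T h ≡ᵇ 1) (hexagons n))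

isDimerᵇ : Tile → Bool
isDimerᵇ (_ ∷ _ ∷ []) = true
isDimerᵇ _            = false

numDimers : List Tile → ℕ
numDimers T = length (filterᵇ isDimerᵇ T)

tilings : ℕ → List (List Tile)
tilings n = filterᵇ (isPartitionᵇ n) (sublists (tiles n))

c : ℕ → ℤ → ℕ
c n (+ k)      = length (filterᵇ (λ T → numDimers T ≡ᵇ k) (tilings n))
c n -[1+ _ ]   = 0

module Submission where

-- Classify the tilings of H_n by the tile covering the last hexagon n: the monomer {n}, the
-- slanted dimer {n-1,n} or the horizontal dimer {n-2,n}.  In the last case hexagon n-1 can only
-- be covered by the monomer {n-1} or by the horizontal dimer {n-3,n-1}; this gives the four terms.
-- A tiling is a sublist of the list  tiles n  satisfying a Boolean predicate, and  tiles (n+1)  is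
-- a permutation of  lastTiles n ++ tiles n,  where the new tiles all contain hexagon n+1 and the
-- old ones do not.  Since the predicates involved are invariant under permutation, a count of
-- sublists splits according to which new tile, if any, is used.

open import Defs
open import Function using (_∘_; id; Equivalence)
open import Data.Bool using (Bool; true; false; _∧_; if_then_else_; T?)
open import Data.Bool.Properties using (∧-assoc; ∧-comm; ∧-identityʳ; ∧-zeroʳ; ∨-zeroʳ; T-≡; ¬-not)
open import Data.Bool.ListAction using (and)
open import Data.Nat using (ℕ; zero; suc; _+_; _∸_; _≤_; _<_; _≡ᵇ_; s≤s)
open import Data.Nat.Properties
  using (≤-refl; ≤-trans; n≤1+n; m≤n+m; m≤n⇒m≤1+n; <⇒≢; >⇒≢; ≡ᵇ⇒≡; ≡⇒≡ᵇ; +-comm; +-assoc; +-identityʳ;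
         +-commutativeSemigroup)
open import Algebra.Properties.CommutativeSemigroup +-commutativeSemigroup using (interchange)
open import Data.Nat.ListAction using (sum)
open import Data.Integer using (ℤ; +_; -[1+_]) renaming (_-_ to _-ℤ_)
open import Data.Product using (_×_; _,_)
open import Data.List using (List; []; _∷_; _++_; [_]; map; length; filterᵇ; upTo)
open import Data.List.Properties using (length-++; filter-++; map-++; map-cong; ++-assoc; upTo-∷ʳ)
open import Data.List.Relation.Unary.All using (All; []; _∷_)
import Data.List.Relation.Unary.All as All
import Data.List.Relation.Unary.All.Properties as All
open import Data.List.Relation.Binary.Permutation.Propositional
  using (_↭_; refl; prep; swap; trans; ↭-sym; ↭-reflexive; ↭-trans; ↭⇒↭ₛ; ↭ₛ⇒↭)
open import Data.List.Relation.Binary.Permutation.Propositional.Properties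
  using (↭-length; shift; ++-comm; All-resp-↭; ++⁺)
import Data.List.Relation.Binary.Permutation.Setoid.Properties as Permₛ
open import Relation.Binary.PropositionalEquality
  using (_≡_; _≢_; cong; cong₂; sym; setoid; module ≡-Reasoning)
  renaming (refl to ≡-refl; trans to ≡-trans)

private
  variable
    A B : Set

countSublists : (List A → Bool) → List A → ℕ
countSublists P []       = if P [] then 1 else 0
countSublists P (x ∷ xs) = countSublists P xs + countSublists (λ ys → P (x ∷ ys)) xs

length-filterᵇ-++ : ∀ (p : A → Bool) xs ys →
                    length (filterᵇ p (xs ++ ys)) ≡ length (filterᵇ p xs) + length (filterᵇ p ys)
length-filterᵇ-++ p xs ys = ≡-trans (cong length (filter-++ (T? ∘ p) xs ys)) (length-++ (filterᵇ p xs))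

length-filterᵇ-map : ∀ (p : B → Bool) (f : A → B) xs →
                     length (filterᵇ p (map f xs)) ≡ length (filterᵇ (p ∘ f) xs)
length-filterᵇ-map p f []       = ≡-refl
length-filterᵇ-map p f (x ∷ xs) with p (f x)
... | true  = cong suc (length-filterᵇ-map p f xs)
... | false = length-filterᵇ-map p f xs

length-filterᵇ-filterᵇ : ∀ (p q : A → Bool) xs →
                         length (filterᵇ q (filterᵇ p xs)) ≡ length (filterᵇ (λ x → p x ∧ q x) xs)
length-filterᵇ-filterᵇ p q []       = ≡-refl
length-filterᵇ-filterᵇ p q (x ∷ xs) with p x
... | false = length-filterᵇ-filterᵇ p q xs
... | true with q x
...   | true  = cong suc (length-filterᵇ-filterᵇ p q xs)
...   | false = length-filterᵇ-filterᵇ p q xs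

length-filterᵇ-↭ : ∀ (p : A → Bool) {xs ys} → xs ↭ ys → length (filterᵇ p xs) ≡ length (filterᵇ p ys)
length-filterᵇ-↭ p xs↭ys =
  ↭-length (↭ₛ⇒↭ (Permₛ.filter⁺ (setoid _) (T? ∘ p) (λ { ≡-refl → id }) (↭⇒↭ₛ xs↭ys)))

length-filterᵇ-sublists : ∀ (P : List A → Bool) xs → length (filterᵇ P (sublists xs)) ≡ countSublists P xs
length-filterᵇ-sublists P [] with P []
... | true  = ≡-refl
... | false = ≡-refl
length-filterᵇ-sublists P (x ∷ xs) = begin
  length (filterᵇ P (sublists xs ++ map (x ∷_) (sublists xs)))
    ≡⟨ length-filterᵇ-++ P (sublists xs) _ ⟩
  length (filterᵇ P (sublists xs)) + length (filterᵇ P (map (x ∷_) (sublists xs)))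
    ≡⟨ cong₂ _+_ (length-filterᵇ-sublists P xs)
                 (≡-trans (length-filterᵇ-map P (x ∷_) (sublists xs))
                          (length-filterᵇ-sublists (λ ys → P (x ∷ ys)) xs)) ⟩
  countSublists P (x ∷ xs) ∎
  where open ≡-Reasoning

countSublists-cong : ∀ {P Q : List A → Bool} xs → (∀ ys → P ys ≡ Q ys) →
                     countSublists P xs ≡ countSublists Q xs
countSublists-cong []       P≗Q = cong (λ b → if b then 1 else 0) (P≗Q [])
countSublists-cong (x ∷ xs) P≗Q =
  cong₂ _+_ (countSublists-cong xs P≗Q) (countSublists-cong xs (λ ys → P≗Q (x ∷ ys)))

countSublists-cong-All : ∀ {R : A → Set} {P Q : List A → Bool} xs → All R xs →
                         (∀ ys → All R ys → P ys ≡ Q ys) → countSublists P xs ≡ countSublists Q xs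
countSublists-cong-All []       []         P≗Q = cong (λ b → if b then 1 else 0) (P≗Q [] [])
countSublists-cong-All (x ∷ xs) (Rx ∷ Rxs) P≗Q =
  cong₂ _+_ (countSublists-cong-All xs Rxs P≗Q)
            (countSublists-cong-All xs Rxs (λ ys Rys → P≗Q (x ∷ ys) (Rx ∷ Rys)))

countSublists-false : ∀ (xs : List A) → countSublists (λ _ → false) xs ≡ 0
countSublists-false []       = ≡-refl
countSublists-false (x ∷ xs) = cong₂ _+_ (countSublists-false xs) (countSublists-false xs)

PermutationInvariant : (List A → Bool) → Set
PermutationInvariant P = ∀ {xs ys} → xs ↭ ys → P xs ≡ P ys

∧-permutationInvariant : ∀ {P Q : List A → Bool} → PermutationInvariant P → PermutationInvariant Q →
                         PermutationInvariant (λ xs → P xs ∧ Q xs)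
∧-permutationInvariant P-inv Q-inv xs↭ys = cong₂ _∧_ (P-inv xs↭ys) (Q-inv xs↭ys)

countSublists-↭ : ∀ {P : List A → Bool} → PermutationInvariant P → ∀ {xs ys} → xs ↭ ys →
                  countSublists P xs ≡ countSublists P ys
countSublists-↭ P-inv refl         = ≡-refl
countSublists-↭ P-inv (prep x p)   =
  cong₂ _+_ (countSublists-↭ P-inv p) (countSublists-↭ (P-inv ∘ prep x) p)
countSublists-↭ P-inv (trans p q)  = ≡-trans (countSublists-↭ P-inv p) (countSublists-↭ P-inv q)
countSublists-↭ {P = P} P-inv {_ ∷ _ ∷ xs} {_ ∷ _ ∷ ys} (swap x y p) = begin
  (# P xs + # (P ∘ (y ∷_)) xs) + (# (P ∘ (x ∷_)) xs + # (P ∘ (λ zs → x ∷ y ∷ zs)) xs)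
    ≡⟨ cong₂ _+_ (cong₂ _+_ (countSublists-↭ P-inv p) (countSublists-↭ (P-inv ∘ prep y) p))
                 (cong₂ _+_ (countSublists-↭ (P-inv ∘ prep x) p)
                            (countSublists-↭ (P-inv ∘ prep x ∘ prep y) p)) ⟩
  (# P ys + # (P ∘ (y ∷_)) ys) + (# (P ∘ (x ∷_)) ys + # (P ∘ (λ zs → x ∷ y ∷ zs)) ys)
    ≡⟨ interchange (# P ys) _ _ _ ⟩
  (# P ys + # (P ∘ (x ∷_)) ys) + (# (P ∘ (y ∷_)) ys + # (P ∘ (λ zs → x ∷ y ∷ zs)) ys)
    ≡⟨ cong (λ n → (# P ys + # (P ∘ (x ∷_)) ys) + (# (P ∘ (y ∷_)) ys + n))
            (countSublists-cong ys (λ zs → P-inv (swap x y refl))) ⟩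
  (# P ys + # (P ∘ (x ∷_)) ys) + (# (P ∘ (y ∷_)) ys + # (P ∘ (λ zs → y ∷ x ∷ zs)) ys) ∎
  where
  open ≡-Reasoning
  # : (List A → Bool) → List A → ℕ
  # = countSublists

≡ᵇ-refl : ∀ n → (n ≡ᵇ n) ≡ true
≡ᵇ-refl n = Equivalence.to T-≡ (≡⇒≡ᵇ n n ≡-refl)

≢⇒≡ᵇ-false : ∀ {m n} → m ≢ n → (m ≡ᵇ n) ≡ false
≢⇒≡ᵇ-false {m} {n} m≢n = ¬-not (λ m≡ᵇn → m≢n (≡ᵇ⇒≡ m n (Equivalence.from T-≡ m≡ᵇn)))

memberᵇ-here : ∀ h t → memberᵇ h (h ∷ t) ≡ true
memberᵇ-here h t rewrite ≡ᵇ-refl h = ≡-refl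

memberᵇ-there : ∀ h x t → memberᵇ h t ≡ true → memberᵇ h (x ∷ t) ≡ true
memberᵇ-there h x t h∈t rewrite h∈t = ∨-zeroʳ (h ≡ᵇ x)

memberᵇ-false : ∀ {h} t → All (h ≢_) t → memberᵇ h t ≡ false
memberᵇ-false []      []           = ≡-refl
memberᵇ-false (x ∷ t) (h≢x ∷ h∉t) rewrite ≢⇒≡ᵇ-false h≢x = memberᵇ-false t h∉t

cover-∷-∈ : ∀ t T h → memberᵇ h t ≡ true → cover (t ∷ T) h ≡ suc (cover T h)
cover-∷-∈ t T h h∈t rewrite h∈t = ≡-refl

cover-∷-∉ : ∀ t T h → memberᵇ h t ≡ false → cover (t ∷ T) h ≡ cover T h
cover-∷-∉ t T h h∉t rewrite h∉t = ≡-refl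

cover-none : ∀ h T → All (λ t → memberᵇ h t ≡ false) T → cover T h ≡ 0
cover-none h []      []           = ≡-refl
cover-none h (t ∷ T) (h∉t ∷ h∉T) = ≡-trans (cover-∷-∉ t T h h∉t) (cover-none h T h∉T)

memberᵇ-above : ∀ {n} t → All (n <_) t → memberᵇ n t ≡ false
memberᵇ-above t n<t = memberᵇ-false t (All.map <⇒≢ n<t)

memberᵇ-below : ∀ {n} t → All (_≤ n) t → memberᵇ (suc n) t ≡ false
memberᵇ-below t t≤n = memberᵇ-false t (All.map (λ x≤n → >⇒≢ (s≤s x≤n)) t≤n)

cover≡ᵇ-permutationInvariant : ∀ h j → PermutationInvariant (λ T → cover T h ≡ᵇ j)
cover≡ᵇ-permutationInvariant h j T↭U = cong (_≡ᵇ j) (length-filterᵇ-↭ (memberᵇ h) T↭U)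

hexagons-suc : ∀ n → hexagons (suc n) ≡ hexagons n ++ [ suc n ]
hexagons-suc n = ≡-trans (cong (map suc) (sym (upTo-∷ʳ n))) (map-++ suc (upTo n) [ n ])

and-∷ʳ : ∀ bs b → and (bs ++ [ b ]) ≡ and bs ∧ b
and-∷ʳ []       b = ∧-identityʳ b
and-∷ʳ (c ∷ bs) b = ≡-trans (cong (c ∧_) (and-∷ʳ bs b)) (sym (∧-assoc c (and bs) b))

isPartitionᵇ-suc : ∀ n T → isPartitionᵇ (suc n) T ≡ isPartitionᵇ n T ∧ (cover T (suc n) ≡ᵇ 1)
isPartitionᵇ-suc n T = begin
  and (map covered-once (hexagons (suc n)))
    ≡⟨ cong (and ∘ map covered-once) (hexagons-suc n) ⟩
  and (map covered-once (hexagons n ++ [ suc n ]))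
    ≡⟨ cong and (map-++ covered-once (hexagons n) [ suc n ]) ⟩
  and (map covered-once (hexagons n) ++ [ covered-once (suc n) ])
    ≡⟨ and-∷ʳ (map covered-once (hexagons n)) (covered-once (suc n)) ⟩
  isPartitionᵇ n T ∧ covered-once (suc n) ∎
  where
  open ≡-Reasoning
  covered-once : ℕ → Bool
  covered-once h = cover T h ≡ᵇ 1

isPartitionᵇ-∷-above : ∀ n t T → All (n <_) t → isPartitionᵇ n (t ∷ T) ≡ isPartitionᵇ n T
isPartitionᵇ-∷-above zero    t T _   = ≡-refl
isPartitionᵇ-∷-above (suc n) t T n<t = begin
  isPartitionᵇ (suc n) (t ∷ T)
    ≡⟨ isPartitionᵇ-suc n (t ∷ T) ⟩
  isPartitionᵇ n (t ∷ T) ∧ (cover (t ∷ T) (suc n) ≡ᵇ 1)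
    ≡⟨ cong₂ _∧_ (isPartitionᵇ-∷-above n t T (All.map (≤-trans (n≤1+n _)) n<t))
                 (cong (_≡ᵇ 1) (cover-∷-∉ t T (suc n) (memberᵇ-above t n<t))) ⟩
  isPartitionᵇ n T ∧ (cover T (suc n) ≡ᵇ 1)
    ≡⟨ sym (isPartitionᵇ-suc n T) ⟩
  isPartitionᵇ (suc n) T ∎
  where open ≡-Reasoning

isPartitionᵇ-∷-top : ∀ n t T → All (n <_) t → memberᵇ (suc n) t ≡ true →
                     isPartitionᵇ (suc n) (t ∷ T) ≡ isPartitionᵇ n T ∧ (cover T (suc n) ≡ᵇ 0)
isPartitionᵇ-∷-top n t T n<t sn∈t =
  ≡-trans (isPartitionᵇ-suc n (t ∷ T))
          (cong₂ _∧_ (isPartitionᵇ-∷-above n t T n<t) (cong (_≡ᵇ 1) (cover-∷-∈ t T (suc n) sn∈t)))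

-- the tiles of H_{m+1} containing its last hexagon m+1 (note the shift of index)
lastTiles : ℕ → List Tile
lastTiles zero          = [ 1 ∷ [] ]
lastTiles (suc zero)    = (2 ∷ []) ∷ (1 ∷ 2 ∷ []) ∷ []
lastTiles (suc (suc m)) = (3+m ∷ []) ∷ (suc (suc m) ∷ 3+m ∷ []) ∷ (suc m ∷ 3+m ∷ []) ∷ []
  where
  3+m : ℕ
  3+m = suc (suc (suc m))

tiles-suc-↭ : ∀ m → tiles (suc m) ↭ lastTiles m ++ tiles m
tiles-suc-↭ zero          = refl
tiles-suc-↭ (suc zero)    = ++-comm [ 1 ∷ [] ] ((2 ∷ []) ∷ (1 ∷ 2 ∷ []) ∷ [])
tiles-suc-↭ (suc (suc j)) = ↭-trans (↭-reflexive (cong₂ _++_ monomers-suc (cong₂ _++_ slanted-suc horizontal-suc)))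
                                    (move-to-front (monomers m) (slanted m) (horizontal m))
  where
  m : ℕ
  m = suc (suc j)
  monomers-suc : monomers (suc m) ≡ monomers m ++ [ suc m ∷ [] ]
  monomers-suc = ≡-trans (cong (map (λ i → i ∷ [])) (hexagons-suc m)) (map-++ _ (hexagons m) _)
  slanted-suc : slanted (suc m) ≡ slanted m ++ [ m ∷ suc m ∷ [] ]
  slanted-suc = ≡-trans (cong (map (λ i → i ∷ suc i ∷ [])) (hexagons-suc (suc j))) (map-++ _ (hexagons (suc j)) _)
  horizontal-suc : horizontal (suc m) ≡ horizontal m ++ [ suc j ∷ suc m ∷ [] ]
  horizontal-suc = ≡-trans (cong (map (λ i → i ∷ suc (suc i) ∷ [])) (hexagons-suc j)) (map-++ _ (hexagons j) _)
  move-to-front : ∀ {a b c : Tile} M S H → (M ++ [ a ]) ++ (S ++ [ b ]) ++ (H ++ [ c ]) ↭ a ∷ b ∷ c ∷ M ++ S ++ H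
  move-to-front {a} {b} {c} M S H =
    ↭-trans (++⁺ (++-comm M [ a ]) (++⁺ (++-comm S [ b ]) (++-comm H [ c ])))
    (prep a (↭-trans (shift b M (S ++ c ∷ H))
    (prep b (↭-trans (↭-reflexive (sym (++-assoc M S (c ∷ H))))
    (↭-trans (shift c (M ++ S) H) (prep c (↭-reflexive (++-assoc M S H))))))))

lastTiles-∋ : ∀ m → All (λ t → memberᵇ (suc m) t ≡ true) (lastTiles m)
lastTiles-∋ zero          = memberᵇ-here 1 [] ∷ []
lastTiles-∋ (suc zero)    = memberᵇ-here 2 [] ∷ memberᵇ-there 2 1 [ 2 ] (memberᵇ-here 2 []) ∷ []
lastTiles-∋ (suc (suc j)) = memberᵇ-here 3+j []
                          ∷ memberᵇ-there 3+j (suc (suc j)) [ 3+j ] (memberᵇ-here 3+j [])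
                          ∷ memberᵇ-there 3+j (suc j) [ 3+j ] (memberᵇ-here 3+j []) ∷ []
  where 3+j = suc (suc (suc j))

lastTiles-≤ : ∀ m → All (All (_≤ suc m)) (lastTiles m)
lastTiles-≤ zero          = (≤-refl ∷ []) ∷ []
lastTiles-≤ (suc zero)    = (≤-refl ∷ []) ∷ (n≤1+n 1 ∷ ≤-refl ∷ []) ∷ []
lastTiles-≤ (suc (suc j)) = (≤-refl ∷ [])
                          ∷ (n≤1+n (suc (suc j)) ∷ ≤-refl ∷ [])
                          ∷ (≤-trans (n≤1+n (suc j)) (n≤1+n (suc (suc j))) ∷ ≤-refl ∷ []) ∷ []

tiles-≤ : ∀ m → All (All (_≤ m)) (tiles m)
tiles-≤ zero    = []
tiles-≤ (suc m) = All-resp-↭ (↭-sym (tiles-suc-↭ m))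
                             (All.++⁺ (lastTiles-≤ m) (All.map (All.map m≤n⇒m≤1+n) (tiles-≤ m)))

tiles-∌ : ∀ m → All (λ t → memberᵇ (suc m) t ≡ false) (tiles m)
tiles-∌ m = All.map (memberᵇ-below _) (tiles-≤ m)

countSublists-cover≡0 : ∀ (X : List Tile → Bool) h As L →
                        All (λ t → memberᵇ h t ≡ true) As → All (λ t → memberᵇ h t ≡ false) L →
                        countSublists (λ T → X T ∧ (cover T h ≡ᵇ 0)) (As ++ L) ≡ countSublists X L
countSublists-cover≡0 X h [] L [] h∉L = countSublists-cong-All L h∉L (λ T h∉T →
  ≡-trans (cong (λ k → X T ∧ (k ≡ᵇ 0)) (cover-none h T h∉T)) (∧-identityʳ (X T)))
countSublists-cover≡0 X h (a ∷ As) L (h∈a ∷ h∈As) h∉L = begin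
  countSublists (λ T → X T ∧ (cover T h ≡ᵇ 0)) (As ++ L)
    + countSublists (λ T → X (a ∷ T) ∧ (cover (a ∷ T) h ≡ᵇ 0)) (As ++ L)
    ≡⟨ cong₂ _+_ (countSublists-cover≡0 X h As L h∈As h∉L)
                 (≡-trans (countSublists-cong (As ++ L) (λ T →
                             ≡-trans (cong (λ k → X (a ∷ T) ∧ (k ≡ᵇ 0)) (cover-∷-∈ a T h h∈a))
                                     (∧-zeroʳ (X (a ∷ T)))))
                          (countSublists-false (As ++ L))) ⟩
  countSublists X L + 0
    ≡⟨ +-identityʳ _ ⟩
  countSublists X L ∎
  where open ≡-Reasoning

countSublists-cover≡1 : ∀ (X : List Tile → Bool) h As L →
                        All (λ t → memberᵇ h t ≡ true) As → All (λ t → memberᵇ h t ≡ false) L →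
                        countSublists (λ T → X T ∧ (cover T h ≡ᵇ 1)) (As ++ L)
                          ≡ sum (map (λ a → countSublists (λ T → X (a ∷ T)) L) As)
countSublists-cover≡1 X h [] L [] h∉L = ≡-trans (countSublists-cong-All L h∉L (λ T h∉T →
  ≡-trans (cong (λ k → X T ∧ (k ≡ᵇ 1)) (cover-none h T h∉T)) (∧-zeroʳ (X T)))) (countSublists-false L)
countSublists-cover≡1 X h (a ∷ As) L (h∈a ∷ h∈As) h∉L = begin
  countSublists (λ T → X T ∧ (cover T h ≡ᵇ 1)) (As ++ L)
    + countSublists (λ T → X (a ∷ T) ∧ (cover (a ∷ T) h ≡ᵇ 1)) (As ++ L)
    ≡⟨ cong₂ _+_ (countSublists-cover≡1 X h As L h∈As h∉L)
                 (≡-trans (countSublists-cong (As ++ L) (λ T →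
                             cong (λ k → X (a ∷ T) ∧ (k ≡ᵇ 1)) (cover-∷-∈ a T h h∈a)))
                          (countSublists-cover≡0 (λ T → X (a ∷ T)) h As L h∈As h∉L)) ⟩
  sum (map (λ b → countSublists (λ T → X (b ∷ T)) L) As) + countSublists (λ T → X (a ∷ T)) L
    ≡⟨ +-comm (sum (map (λ b → countSublists (λ T → X (b ∷ T)) L) As)) _ ⟩
  sum (map (λ b → countSublists (λ T → X (b ∷ T)) L) (a ∷ As)) ∎
  where open ≡-Reasoning

tiles-cover≡0 : ∀ m {X} → PermutationInvariant X →
                countSublists (λ T → X T ∧ (cover T (suc m) ≡ᵇ 0)) (tiles (suc m)) ≡ countSublists X (tiles m)
tiles-cover≡0 m {X} X-inv =
  ≡-trans (countSublists-↭ (∧-permutationInvariant X-inv (cover≡ᵇ-permutationInvariant (suc m) 0)) (tiles-suc-↭ m))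
          (countSublists-cover≡0 X (suc m) (lastTiles m) (tiles m) (lastTiles-∋ m) (tiles-∌ m))

tiles-cover≡1 : ∀ m {X} → PermutationInvariant X →
                countSublists (λ T → X T ∧ (cover T (suc m) ≡ᵇ 1)) (tiles (suc m))
                  ≡ sum (map (λ t → countSublists (λ T → X (t ∷ T)) (tiles m)) (lastTiles m))
tiles-cover≡1 m {X} X-inv =
  ≡-trans (countSublists-↭ (∧-permutationInvariant X-inv (cover≡ᵇ-permutationInvariant (suc m) 1)) (tiles-suc-↭ m))
          (countSublists-cover≡1 X (suc m) (lastTiles m) (tiles m) (lastTiles-∋ m) (tiles-∌ m))

-- D constrains the number of dimers; c n k is the case D = (_≡ᵇ k).
IsTilingWith : ℕ → (ℕ → Bool) → List Tile → Bool
IsTilingWith n D T = D (numDimers T) ∧ isPartitionᵇ n T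

tilingsWith : ℕ → (ℕ → Bool) → ℕ
tilingsWith n D = countSublists (IsTilingWith n D) (tiles n)

-- Applied to sublists of  tiles (suc n):  tilings of H_n that leave hexagon n+1 free.
IsNotchedTilingWith : ℕ → (ℕ → Bool) → List Tile → Bool
IsNotchedTilingWith n D T = IsTilingWith n D T ∧ (cover T (suc n) ≡ᵇ 0)

isTilingWith-permutationInvariant : ∀ n D → PermutationInvariant (IsTilingWith n D)
isTilingWith-permutationInvariant n D T↭U =
  cong₂ _∧_ (cong D (length-filterᵇ-↭ isDimerᵇ T↭U))
            (cong and (map-cong (λ h → cover≡ᵇ-permutationInvariant h 1 T↭U) (hexagons n)))

isNotchedTilingWith-permutationInvariant : ∀ n D → PermutationInvariant (IsNotchedTilingWith n D)
isNotchedTilingWith-permutationInvariant n D =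
  ∧-permutationInvariant (isTilingWith-permutationInvariant n D) (cover≡ᵇ-permutationInvariant (suc n) 0)

isTilingWith-suc : ∀ n D T → IsTilingWith (suc n) D T ≡ IsTilingWith n D T ∧ (cover T (suc n) ≡ᵇ 1)
isTilingWith-suc n D T =
  ≡-trans (cong (D (numDimers T) ∧_) (isPartitionᵇ-suc n T)) (sym (∧-assoc (D (numDimers T)) _ _))

isTilingWith-∷-monomer : ∀ n D x T → n < x → IsTilingWith n D ((x ∷ []) ∷ T) ≡ IsTilingWith n D T
isTilingWith-∷-monomer n D x T n<x = cong (D (numDimers T) ∧_) (isPartitionᵇ-∷-above n (x ∷ []) T (n<x ∷ []))

isTilingWith-∷-dimerOnTop : ∀ n D x y T → n < x → n < y → memberᵇ (suc n) (x ∷ y ∷ []) ≡ true →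
                            IsTilingWith (suc n) D ((x ∷ y ∷ []) ∷ T) ≡ IsNotchedTilingWith n (D ∘ suc) T
isTilingWith-∷-dimerOnTop n D x y T n<x n<y sn∈t =
  ≡-trans (cong (D (suc (numDimers T)) ∧_) (isPartitionᵇ-∷-top n (x ∷ y ∷ []) T (n<x ∷ n<y ∷ []) sn∈t))
          (sym (∧-assoc (D (suc (numDimers T))) _ _))

notchedTilingsWith≡tilingsWith : ∀ n D →
  countSublists (IsNotchedTilingWith n D) (tiles (suc n)) ≡ tilingsWith n D
notchedTilingsWith≡tilingsWith n D = tiles-cover≡0 n (isTilingWith-permutationInvariant n D)

tilingsWith-suc : ∀ n D →
  tilingsWith (suc n) D ≡ sum (map (λ t → countSublists (λ T → IsTilingWith n D (t ∷ T)) (tiles n)) (lastTiles n))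
tilingsWith-suc n D = ≡-trans (countSublists-cong (tiles (suc n)) (isTilingWith-suc n D))
                              (tiles-cover≡1 n (isTilingWith-permutationInvariant n D))

tilingsWith-monomerOnTop : ∀ n D →
  countSublists (λ T → IsTilingWith n D ((suc n ∷ []) ∷ T)) (tiles n) ≡ tilingsWith n D
tilingsWith-monomerOnTop n D =
  countSublists-cong (tiles n) (λ T → isTilingWith-∷-monomer n D (suc n) T ≤-refl)

tilingsWith-slantedOnTop : ∀ n D →
  countSublists (λ T → IsTilingWith (suc n) D ((suc n ∷ suc (suc n) ∷ []) ∷ T)) (tiles (suc n))
    ≡ tilingsWith n (D ∘ suc)
tilingsWith-slantedOnTop n D =
  ≡-trans (countSublists-cong (tiles (suc n)) (λ T →
             isTilingWith-∷-dimerOnTop n D (suc n) (suc (suc n)) T ≤-refl (n≤1+n (suc n))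
                                       (memberᵇ-here (suc n) [ suc (suc n) ])))
          (notchedTilingsWith≡tilingsWith n (D ∘ suc))

notchedTilingsWith-monomerOnTop : ∀ n D →
  countSublists (λ T → IsNotchedTilingWith n D ((suc (suc n) ∷ []) ∷ T)) (tiles (suc n)) ≡ tilingsWith n D
notchedTilingsWith-monomerOnTop n D = ≡-trans
  (countSublists-cong (tiles (suc n)) (λ T →
     cong₂ _∧_ (isTilingWith-∷-monomer n D (suc (suc n)) T (n≤1+n (suc n)))
               (cong (_≡ᵇ 0) (cover-∷-∉ (suc (suc n) ∷ []) T (suc n)
                                        (memberᵇ-false (suc (suc n) ∷ []) (<⇒≢ ≤-refl ∷ []))))))
  (notchedTilingsWith≡tilingsWith n D)

notchedTilingsWith-slantedOnTop : ∀ n D →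
  countSublists (λ T → IsNotchedTilingWith n D ((suc n ∷ suc (suc n) ∷ []) ∷ T)) (tiles (suc n)) ≡ 0
notchedTilingsWith-slantedOnTop n D = ≡-trans
  (countSublists-cong (tiles (suc n)) (λ T →
     ≡-trans (cong (λ k → IsTilingWith n D ((suc n ∷ suc (suc n) ∷ []) ∷ T) ∧ (k ≡ᵇ 0))
                   (cover-∷-∈ (suc n ∷ suc (suc n) ∷ []) T (suc n) (memberᵇ-here (suc n) [ suc (suc n) ])))
             (∧-zeroʳ _)))
  (countSublists-false (tiles (suc n)))

notchedTilingsWith-horizontalOnTop : ∀ n D →
  countSublists (λ T → IsNotchedTilingWith (suc n) D ((suc n ∷ suc (suc (suc n)) ∷ []) ∷ T)) (tiles (suc (suc n)))
    ≡ tilingsWith n (D ∘ suc)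
notchedTilingsWith-horizontalOnTop n D = begin
  countSublists (λ T → IsNotchedTilingWith (suc n) D (top ∷ T)) (tiles (suc (suc n)))
    ≡⟨ countSublists-cong (tiles (suc (suc n))) (λ T →
         cong₂ _∧_ (isTilingWith-∷-dimerOnTop n D (suc n) 3+n T ≤-refl (m≤n+m (suc n) 2)
                                              (memberᵇ-here (suc n) [ 3+n ]))
                   (cong (_≡ᵇ 0) (cover-∷-∉ top T (suc (suc n))
                                            (memberᵇ-false top (>⇒≢ ≤-refl ∷ <⇒≢ ≤-refl ∷ []))))) ⟩
  countSublists (λ T → IsNotchedTilingWith n (D ∘ suc) T ∧ (cover T (suc (suc n)) ≡ᵇ 0)) (tiles (suc (suc n)))
    ≡⟨ tiles-cover≡0 (suc n) (isNotchedTilingWith-permutationInvariant n (D ∘ suc)) ⟩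
  countSublists (IsNotchedTilingWith n (D ∘ suc)) (tiles (suc n))
    ≡⟨ notchedTilingsWith≡tilingsWith n (D ∘ suc) ⟩
  tilingsWith n (D ∘ suc) ∎
  where
  open ≡-Reasoning
  3+n : ℕ
  3+n = suc (suc (suc n))
  top : Tile
  top = suc n ∷ 3+n ∷ []

tilingsWith-horizontalOnTop : ∀ n D →
  countSublists (λ T → IsTilingWith (suc (suc (suc n))) D ((suc (suc n) ∷ suc (suc (suc (suc n))) ∷ []) ∷ T))
                (tiles (suc (suc (suc n))))
    ≡ tilingsWith (suc n) (D ∘ suc) + tilingsWith n (D ∘ suc ∘ suc)
tilingsWith-horizontalOnTop n D = begin
  countSublists (λ T → IsTilingWith 3+n D (top ∷ T)) (tiles 3+n)
    ≡⟨ countSublists-cong (tiles 3+n) remove-top ⟩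
  countSublists (λ T → Notched T ∧ (cover T 3+n ≡ᵇ 1)) (tiles 3+n)
    ≡⟨ tiles-cover≡1 2+n (isNotchedTilingWith-permutationInvariant (suc n) (D ∘ suc)) ⟩
  countSublists (λ T → Notched ((3+n ∷ []) ∷ T)) (tiles 2+n)
    + (countSublists (λ T → Notched ((2+n ∷ 3+n ∷ []) ∷ T)) (tiles 2+n)
    + (countSublists (λ T → Notched ((suc n ∷ 3+n ∷ []) ∷ T)) (tiles 2+n) + 0))
    ≡⟨ cong₂ _+_ (notchedTilingsWith-monomerOnTop (suc n) (D ∘ suc))
                 (cong₂ _+_ (notchedTilingsWith-slantedOnTop (suc n) (D ∘ suc))
                            (≡-trans (+-identityʳ _) (notchedTilingsWith-horizontalOnTop n (D ∘ suc)))) ⟩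
  tilingsWith (suc n) (D ∘ suc) + tilingsWith n (D ∘ suc ∘ suc) ∎
  where
  open ≡-Reasoning
  2+n : ℕ
  2+n = suc (suc n)
  3+n : ℕ
  3+n = suc 2+n
  4+n : ℕ
  4+n = suc 3+n
  top : Tile
  top = 2+n ∷ 4+n ∷ []
  Notched : List Tile → Bool
  Notched = IsNotchedTilingWith (suc n) (D ∘ suc)
  remove-top : ∀ T → IsTilingWith 3+n D (top ∷ T) ≡ Notched T ∧ (cover T 3+n ≡ᵇ 1)
  remove-top T = ≡-trans (isTilingWith-suc 2+n D (top ∷ T))
    (cong₂ _∧_ (isTilingWith-∷-dimerOnTop (suc n) D 2+n 4+n T ≤-refl (m≤n+m 2+n 2) (memberᵇ-here 2+n [ 4+n ]))
               (cong (_≡ᵇ 1) (cover-∷-∉ top T 3+n (memberᵇ-false top (>⇒≢ ≤-refl ∷ <⇒≢ ≤-refl ∷ [])))))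

tilingsWith-recurrence : ∀ n D →
  tilingsWith (suc (suc (suc (suc n)))) D
    ≡ tilingsWith (suc (suc (suc n))) D + tilingsWith (suc (suc n)) (D ∘ suc)
      + tilingsWith (suc n) (D ∘ suc) + tilingsWith n (D ∘ suc ∘ suc)
tilingsWith-recurrence n D = begin
  tilingsWith (suc 3+n) D
    ≡⟨ tilingsWith-suc 3+n D ⟩
  sum (map (λ t → countSublists (λ T → IsTilingWith 3+n D (t ∷ T)) (tiles 3+n)) (lastTiles 3+n))
    ≡⟨ cong₂ _+_ (tilingsWith-monomerOnTop 3+n D)
                 (cong₂ _+_ (tilingsWith-slantedOnTop (suc (suc n)) D)
                            (≡-trans (+-identityʳ _) (tilingsWith-horizontalOnTop n D))) ⟩
  a + (b + (c′ + d))
    ≡⟨ sym (+-assoc a b (c′ + d)) ⟩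
  (a + b) + (c′ + d)
    ≡⟨ sym (+-assoc (a + b) c′ d) ⟩
  a + b + c′ + d ∎
  where
  open ≡-Reasoning
  3+n : ℕ
  3+n = suc (suc (suc n))
  a : ℕ
  a = tilingsWith 3+n D
  b : ℕ
  b = tilingsWith (suc (suc n)) (D ∘ suc)
  c′ : ℕ
  c′ = tilingsWith (suc n) (D ∘ suc)
  d : ℕ
  d = tilingsWith n (D ∘ suc ∘ suc)

c≡tilingsWith : ∀ n k → c n (+ k) ≡ tilingsWith n (_≡ᵇ k)
c≡tilingsWith n k = begin
  length (filterᵇ (λ T → numDimers T ≡ᵇ k) (filterᵇ (isPartitionᵇ n) (sublists (tiles n))))
    ≡⟨ length-filterᵇ-filterᵇ (isPartitionᵇ n) (λ T → numDimers T ≡ᵇ k) (sublists (tiles n)) ⟩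
  length (filterᵇ (λ T → isPartitionᵇ n T ∧ (numDimers T ≡ᵇ k)) (sublists (tiles n)))
    ≡⟨ length-filterᵇ-sublists _ (tiles n) ⟩
  countSublists (λ T → isPartitionᵇ n T ∧ (numDimers T ≡ᵇ k)) (tiles n)
    ≡⟨ countSublists-cong (tiles n) (λ T → ∧-comm (isPartitionᵇ n T) _) ⟩
  tilingsWith n (_≡ᵇ k) ∎
  where open ≡-Reasoning

-- For k = 0 (resp. k ≤ 1) the left-hand sides are c at a negative index, and no dimer count d
-- satisfies d + 1 ≡ k (resp. d + 2 ≡ k).
c-minus1≡tilingsWith : ∀ n k → c n (+ k -ℤ + 1) ≡ tilingsWith n (λ d → suc d ≡ᵇ k)
c-minus1≡tilingsWith n zero    = sym (countSublists-false (tiles n))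
c-minus1≡tilingsWith n (suc k) = c≡tilingsWith n k

c-minus2≡tilingsWith : ∀ n k → c n (+ k -ℤ + 2) ≡ tilingsWith n (λ d → suc (suc d) ≡ᵇ k)
c-minus2≡tilingsWith n zero          = sym (countSublists-false (tiles n))
c-minus2≡tilingsWith n (suc zero)    = sym (countSublists-false (tiles n))
c-minus2≡tilingsWith n (suc (suc k)) = c≡tilingsWith n k

c-recurrence : (n : ℕ) (k : ℤ) → 4 ≤ n →
               c n k ≡ c (n ∸ 1) k + c (n ∸ 2) (k -ℤ + 1) + c (n ∸ 3) (k -ℤ + 1) + c (n ∸ 4) (k -ℤ + 2)
c-recurrence _ -[1+ _ ] (s≤s (s≤s (s≤s (s≤s _)))) = ≡-refl
c-recurrence (suc (suc (suc (suc n)))) (+ k) (s≤s (s≤s (s≤s (s≤s _)))) = begin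
  c (4 + n) (+ k)
    ≡⟨ c≡tilingsWith (4 + n) k ⟩
  tilingsWith (4 + n) (_≡ᵇ k)
    ≡⟨ tilingsWith-recurrence n (_≡ᵇ k) ⟩
  tilingsWith (3 + n) (_≡ᵇ k) + tilingsWith (2 + n) (λ d → suc d ≡ᵇ k)
    + tilingsWith (1 + n) (λ d → suc d ≡ᵇ k) + tilingsWith n (λ d → suc (suc d) ≡ᵇ k)
    ≡⟨ sym (cong₂ _+_ (cong₂ _+_ (cong₂ _+_ (c≡tilingsWith (3 + n) k) (c-minus1≡tilingsWith (2 + n) k))
                                 (c-minus1≡tilingsWith (1 + n) k))
                      (c-minus2≡tilingsWith n k)) ⟩
  c (3 + n) (+ k) + c (2 + n) (+ k -ℤ + 1) + c (1 + n) (+ k -ℤ + 1) + c n (+ k -ℤ + 2) ∎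
  where open ≡-Reasoning

theorem1 : ((n : ℕ) (k : ℤ) → 4 ≤ n →
             c n k ≡ c (n ∸ 1) k + c (n ∸ 2) (k -ℤ + 1) + c (n ∸ 3) (k -ℤ + 1) + c (n ∸ 4) (k -ℤ + 2))
           × (c 0 (+ 0) ≡ 1) × (c 1 (+ 0) ≡ 1) × (c 2 (+ 0) ≡ 1) × (c 3 (+ 0) ≡ 1)
           × (c 2 (+ 1) ≡ 1) × (c 3 (+ 1) ≡ 3)
theorem1 = c-recurrence , ≡-refl , ≡-refl , ≡-refl , ≡-refl , ≡-refl , ≡-refl
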